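{- Let $\{x_{n,m}\}_{n\in\mathbb{N}^*,\,1\le m\le n}\subset\mathbb{C}$. The following statements are equivalent: (i) $\{x_{n,m}\}$ satisfies the Catalan's triangle system $$x_{n+1,k+1}=\sum_{j=k}^{n}x_{n,j}\qquad\text{for all } n\in\mathbb{N}^* \text{ and } k\in\{1,\ldots,n\};$$ (ii) $\{x_{n,m}\}$ is determined by $\{x_{n,1}\}_{n\in\mathbb{N}^*}$ through the formula $$x_{n,m}=\sum_{h=0}^{n-m}C_{m-1}(h,h+m-2)\,x_{n-m-h+1,1}\qquad\text{for all } n\ge 2 \text{ and } 2\le m\le n,$$ where $C_{m}(n,k)$ denotes the Catalan's trapezoid of order $m$.
   Context: $\mathbb{N}=\{0,1,2,\ldots\}$, $\mathbb{N}^*=\{1,2,\ldots\}$. For $m\in\mathbb{N}^*$, the Catalan's trapezoid of order $m$ is the family $\{C_m(n,k)\}_{n\in\mathbb{N},\,0\le k\le n+m-1}$ given by $C_m(n,k)=\binom{n+k}{k}$ if $0\le k\le m-1$ and $C_m(n,k)=\binom{n+k}{k}-\binom{n+k}{k-m}$ if $m\le k\le n+m-1$; by convention $C_m(n,k)=0$ if $k>n+m-1$. (Combinatorially, $C_m(n,k)$ counts strings of $n$ X's and $k$ Y's in which, in every initial segment, the number of Y's does not exceed the number of X's by more than $m$... i.e. by $m$ or more is forbidden.) -}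

module Defs where

open import Algebra.Bundles using (CommutativeRing)
open import Data.Bool using (if_then_else_)
open import Data.Nat using (ℕ; zero; suc; _+_; _∸_; _≤_; _<ᵇ_; _≤ᵇ_)
open import Data.Nat.Combinatorics using (_C_)

-- Catalan's trapezoid of order m:  C_m(n,k)
--   = binom(n+k,k)                         if 0 ≤ k ≤ m-1
--   = binom(n+k,k) - binom(n+k,k-m)        if m ≤ k ≤ n+m-1
--   = 0                                    if k > n+m-1
-- (In the middle range the difference is nonnegative, so ∸ is exact subtraction.)
catalanTrapezoid : ℕ → ℕ → ℕ → ℕ
catalanTrapezoid m n k =
  if k <ᵇ m then (n + k) C k
  else (if k ≤ᵇ (n + m ∸ 1) then ((n + k) C k) ∸ ((n + k) C (k ∸ m)) else 0)

module _ {c ℓ} (R : CommutativeRing c ℓ) where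
  open CommutativeRing R using (Carrier; _≈_; 0#) renaming (_+_ to _+R_)

  _·_ : ℕ → Carrier → Carrier
  zero · x = 0#
  suc a · x = x +R (a · x)

  -- sumFromTo f a b = Σ_{j=a}^{b} f j   (empty, i.e. 0#, when b < a)
  sumFromTo : (ℕ → Carrier) → ℕ → ℕ → Carrier
  sumFromTo f a b = go (suc b ∸ a) a
    where
    go : ℕ → ℕ → Carrier
    go zero i = 0#
    go (suc l) i = f i +R go l (suc i)

  CatalanTriangleSystem : (ℕ → ℕ → Carrier) → Set ℓ
  CatalanTriangleSystem x =
    ∀ n k → 1 ≤ n → 1 ≤ k → k ≤ n →
      x (suc n) (suc k) ≈ sumFromTo (x n) k n

  TrapezoidFormula : (ℕ → ℕ → Carrier) → Set ℓ
  TrapezoidFormula x =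
    ∀ n m → 2 ≤ n → 2 ≤ m → m ≤ n →
      x n m ≈ sumFromTo
                (λ h → catalanTrapezoid (m ∸ 1) h (h + m ∸ 2) · x ((n ∸ m ∸ h) + 1) 1)
                0 (n ∸ m)

module Submission where

-- With c(t) = 1 + t c(t)² the generating function of the Catalan numbers, the trapezoid
-- entry C_s(h, h+s−1) is the coefficient ballot h s of t^h in c(t)^s, and c = 1 + t c²
-- gives c^(s+1) = c^s + t c^(s+2), i.e. the recurrence defining ballot.  Both (i) and (ii)
-- are equivalent to the closed form
--   x(n+1, s+1) = Σ_{h ≤ n−s} ballot h s · x(n−s−h+1, 1)      (s ≤ n):
-- for (ii) this is a reindexing, and for (i) summing the recurrence of ballot along a row
-- turns the row sum Σ_{j=s+1}^{n+1} x(n+1, j) into the closed form for x(n+2, s+2),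
-- so the two determine each other row by row.

open import Defs
open import Algebra.Bundles using (CommutativeRing; CommutativeMonoid)
open import Data.Bool using (T; true; false; if_then_else_)
open import Data.Empty using (⊥-elim)
open import Data.Nat using (ℕ; zero; suc; _+_; _∸_; _≤_; _<_; z≤n; s≤s; _<ᵇ_; _≤ᵇ_)
open import Data.Nat.Combinatorics using (_C_; nCn≡1; nCk+nC[k+1]≡[n+1]C[k+1])
open import Data.Nat.Properties
  using ( +-suc; +-identityʳ; +-comm; +-commutativeSemigroup; +-∸-assoc; ∸-+-assoc
        ; m+n∸n≡m; m+[n∸m]≡n; m≤m+n; m≤n⇒m∸n≡0; m≤n+m; n<1+n; <⇒≱; +-monoʳ-≤; ≤-trans; ≤-reflexive
        ; <⇒<ᵇ; <ᵇ⇒<; ≤⇒≤ᵇ )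
open import Function.Base using (_∘_)
open import Function.Bundles using (_⇔_; mk⇔)
open import Function.Construct.Composition using (_⇔-∘_)
open import Function.Construct.Symmetry using (⇔-sym)
open import Relation.Binary.PropositionalEquality as ≡ using (_≡_; cong; cong₂; subst₂)
open import Relation.Nullary using (¬_)

module Ballot where
  open ≡.≡-Reasoning
  open import Algebra.Properties.CommutativeSemigroup +-commutativeSemigroup
    using () renaming (interchange to +-interchange)

  if-T : ∀ {a} {A : Set a} {b} {x y : A} → T b → (if b then x else y) ≡ x
  if-T {b = true} _ = ≡.refl

  if-¬T : ∀ {a} {A : Set a} {b} {x y : A} → ¬ T b → (if b then x else y) ≡ y
  if-¬T {b = true}  ¬t = ⊥-elim (¬t _)
  if-¬T {b = false} _  = ≡.refl

  ballot : ℕ → ℕ → ℕ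
  ballot zero    s       = 1
  ballot (suc h) zero    = 0
  ballot (suc h) (suc s) = ballot (suc h) s + ballot h (suc (suc s))

  ballot-binomial : ∀ g s → ballot (suc g) s + (g + suc (g + s)) C g ≡ (g + suc (g + s)) C (g + s)
  ballot-binomial g zero = cong ((g + suc (g + zero)) C_) (≡.sym (+-identityʳ g))
  ballot-binomial zero (suc s) = begin
    ballot 1 s + 1 + 1          ≡⟨ cong (_+ 1) (ballot-binomial zero s) ⟩
    suc s C s + 1               ≡⟨ cong (suc s C s +_) (≡.sym (nCn≡1 (suc s))) ⟩
    suc s C s + suc s C suc s   ≡⟨ nCk+nC[k+1]≡[n+1]C[k+1] (suc s) s ⟩
    suc (suc s) C suc s         ∎
  ballot-binomial (suc g) (suc s) = step (ballot-binomial (suc g) s) (ballot-binomial g (suc (suc s)))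
    where
    M b₁ b₂ : ℕ
    M  = g + suc (suc (g + suc s))
    b₁ = ballot (suc (suc g)) s
    b₂ = ballot (suc g) (suc (suc s))
    step : b₁ + (suc g + suc (suc g + s)) C suc g ≡ (suc g + suc (suc g + s)) C (suc g + s) →
           b₂ + (g + suc (g + suc (suc s))) C g ≡ (g + suc (g + suc (suc s))) C (g + suc (suc s)) →
           (b₁ + b₂) + suc M C suc g ≡ suc M C suc (g + suc s)
    step ih₁ ih₂ = begin
      (b₁ + b₂) + suc M C suc g               ≡⟨ cong ((b₁ + b₂) +_) pascal ⟩
      (b₁ + b₂) + (M C suc g + M C g)         ≡⟨ +-interchange b₁ b₂ (M C suc g) (M C g) ⟩
      (b₁ + M C suc g) + (b₂ + M C g)         ≡⟨ cong₂ _+_ ih₁′ ih₂′ ⟩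
      M C (g + suc s) + M C suc (g + suc s)   ≡⟨ nCk+nC[k+1]≡[n+1]C[k+1] M (g + suc s) ⟩
      suc M C suc (g + suc s)                 ∎
      where
      pascal : suc M C suc g ≡ M C suc g + M C g
      pascal = ≡.trans (≡.sym (nCk+nC[k+1]≡[n+1]C[k+1] M g)) (+-comm (M C g) (M C suc g))
      ih₁′ : b₁ + M C suc g ≡ M C (g + suc s)
      ih₁′ = subst₂ (λ N k → b₁ + N C suc g ≡ N C k)
               (≡.trans (≡.sym (+-suc g _)) (cong (λ t → g + suc (suc t)) (≡.sym (+-suc g s))))
               (≡.sym (+-suc g s))
               ih₁
      ih₂′ : b₂ + M C g ≡ M C suc (g + suc s)
      ih₂′ = subst₂ (λ N k → b₂ + N C g ≡ N C k)
               (cong (λ t → g + suc t) (+-suc g (suc s)))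
               (+-suc g (suc s))
               ih₂

  catalanTrapezoid-ballot : ∀ h s → catalanTrapezoid (suc s) h (h + s) ≡ ballot h (suc s)
  catalanTrapezoid-ballot zero s = ≡.trans (if-T (<⇒<ᵇ (n<1+n s))) (nCn≡1 s)
  catalanTrapezoid-ballot (suc g) s = begin
    catalanTrapezoid (suc s) (suc g) (suc g + s)        ≡⟨ ≡.trans (if-¬T not-low) (if-T middle) ⟩
    N C (suc g + s) ∸ N C (g + s ∸ s)                   ≡⟨ cong₂ (λ k l → N C k ∸ N C l) (≡.sym (+-suc g s)) (m+n∸n≡m g s) ⟩
    N C (g + suc s) ∸ N C g                             ≡⟨ cong (λ L → L C (g + suc s) ∸ L C g) row ⟩
    L C (g + suc s) ∸ L C g                             ≡⟨ cong (_∸ L C g) (≡.sym (ballot-binomial g (suc s))) ⟩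
    ballot (suc g) (suc s) + L C g ∸ L C g              ≡⟨ m+n∸n≡m (ballot (suc g) (suc s)) (L C g) ⟩
    ballot (suc g) (suc s)                              ∎
    where
    N L : ℕ
    N = suc g + (suc g + s)
    L = g + suc (g + suc s)
    not-low : ¬ T (suc g + s <ᵇ suc s)
    not-low t = <⇒≱ (<ᵇ⇒< _ _ t) (s≤s (m≤n+m s g))
    middle : T (suc g + s ≤ᵇ g + suc s)
    middle = ≤⇒≤ᵇ (≤-reflexive (≡.sym (+-suc g s)))
    row : N ≡ L
    row = ≡.trans (≡.sym (+-suc g (suc (g + s)))) (cong (λ t → g + suc t) (≡.sym (+-suc g s)))

open Ballot

module Sum {c ℓ} (M : CommutativeMonoid c ℓ) where
  open CommutativeMonoid M
  open import Algebra.Properties.CommutativeSemigroup commutativeSemigroup using (interchange)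

  sum : ℕ → (ℕ → Carrier) → Carrier
  sum zero    f = ε
  sum (suc l) f = f 0 ∙ sum l (f ∘ suc)

  sum-cong : ∀ l {f g} → (∀ i → i < l → f i ≈ g i) → sum l f ≈ sum l g
  sum-cong zero    f≈g = refl
  sum-cong (suc l) f≈g = ∙-cong (f≈g 0 (s≤s z≤n)) (sum-cong l (λ i i<l → f≈g (suc i) (s≤s i<l)))

  sum-ε : ∀ l → sum l (λ _ → ε) ≈ ε
  sum-ε zero    = refl
  sum-ε (suc l) = trans (identityˡ _) (sum-ε l)

  sum-∙ : ∀ l f g → sum l (λ i → f i ∙ g i) ≈ sum l f ∙ sum l g
  sum-∙ zero    f g = sym (identityʳ ε)
  sum-∙ (suc l) f g = trans (∙-cong refl (sum-∙ l (f ∘ suc) (g ∘ suc))) (interchange _ _ _ _)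

module _ {c ℓ} (R : CommutativeRing c ℓ) where
  open CommutativeRing R
    using (Carrier; _≈_; 0#; +-commutativeMonoid; refl; sym; trans; reflexive; setoid)
    renaming ( _+_ to _⊕_; +-cong to ⊕-cong; +-assoc to ⊕-assoc
             ; +-identityˡ to ⊕-identityˡ; +-identityʳ to ⊕-identityʳ )
  open Sum +-commutativeMonoid
  open import Relation.Binary.Reasoning.Setoid setoid

  _×_ : ℕ → Carrier → Carrier
  _×_ = _·_ R

  ×-homo-+ : ∀ p q v → (p + q) × v ≈ p × v ⊕ q × v
  ×-homo-+ zero    q v = sym (⊕-identityˡ _)
  ×-homo-+ (suc p) q v = trans (⊕-cong refl (×-homo-+ p q v)) (sym (⊕-assoc _ _ _))

  sumFromTo-step : ∀ f {a b} → a ≤ b → sumFromTo R f a b ≡ f a ⊕ sumFromTo R f (suc a) b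
  sumFromTo-step f {a} {b} a≤b with suc b ∸ a | +-∸-assoc 1 a≤b
  ... | .(suc (b ∸ a)) | ≡.refl = ≡.refl

  sumFromTo-empty : ∀ f {a b} → b < a → sumFromTo R f a b ≡ 0#
  sumFromTo-empty f {a} {b} b<a with suc b ∸ a | m≤n⇒m∸n≡0 b<a
  ... | .0 | ≡.refl = ≡.refl

  sumFromTo-sum : ∀ f a l → sumFromTo R f a (a + l) ≈ sum (suc l) (λ i → f (a + i))
  sumFromTo-sum f a zero = begin
    sumFromTo R f a (a + 0)                 ≡⟨ sumFromTo-step f (≤-reflexive (≡.sym (+-identityʳ a))) ⟩
    f a ⊕ sumFromTo R f (suc a) (a + 0)     ≡⟨ cong₂ _⊕_ (cong f (≡.sym (+-identityʳ a)))
                                                         (sumFromTo-empty f (s≤s (≤-reflexive (+-identityʳ a)))) ⟩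
    f (a + 0) ⊕ 0#                          ∎
  sumFromTo-sum f a (suc l) = begin
    sumFromTo R f a (a + suc l)               ≡⟨ sumFromTo-step f (m≤m+n a (suc l)) ⟩
    f a ⊕ sumFromTo R f (suc a) (a + suc l)   ≡⟨ cong₂ _⊕_ (cong f (≡.sym (+-identityʳ a)))
                                                           (cong (sumFromTo R f (suc a)) (+-suc a l)) ⟩
    f (a + 0) ⊕ sumFromTo R f (suc a) (suc a + l)
      ≈⟨ ⊕-cong refl (sumFromTo-sum f (suc a) l) ⟩
    f (a + 0) ⊕ sum (suc l) (λ i → f (suc a + i))
      ≈⟨ ⊕-cong refl (sum-cong (suc l) (λ i _ → reflexive (cong f (≡.sym (+-suc a i))))) ⟩
    sum (suc (suc l)) (λ i → f (a + i))       ∎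

  module _ (x : ℕ → ℕ → Carrier) where
    ballotSum : ℕ → ℕ → Carrier
    ballotSum d s = sum (suc d) (λ h → ballot h s × x (suc (d ∸ h)) 1)

    ballotSum-zero : ∀ n → ballotSum n 0 ≈ x (suc n) 1
    ballotSum-zero n = trans (⊕-cong (⊕-identityʳ _) (sum-ε n)) (⊕-identityʳ _)

    ballotSum-suc : ∀ e s → ballotSum (suc e) (suc s) ≈ ballotSum (suc e) s ⊕ ballotSum e (suc (suc s))
    ballotSum-suc e s =
      trans (⊕-cong refl (trans (sum-cong (suc e) split) (sum-∙ (suc e) first second))) (sym (⊕-assoc _ _ _))
      where
      x′ : ℕ → Carrier
      x′ h = x (suc (e ∸ h)) 1
      first second : ℕ → Carrier
      first  h = ballot (suc h) s × x′ h
      second h = ballot h (suc (suc s)) × x′ h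
      split : ∀ h → h < suc e → ballot (suc h) (suc s) × x′ h ≈ first h ⊕ second h
      split h _ = ×-homo-+ (ballot (suc h) s) (ballot h (suc (suc s))) (x′ h)

    ballotSum-unfold : ∀ e s → ballotSum e (suc s) ≈ sum (suc e) (λ i → ballotSum (e ∸ i) (s + i))
    ballotSum-unfold zero    s = sym (⊕-identityʳ _)
    ballotSum-unfold (suc e) s = begin
      ballotSum (suc e) (suc s)
        ≈⟨ ballotSum-suc e s ⟩
      ballotSum (suc e) s ⊕ ballotSum e (suc (suc s))
        ≈⟨ ⊕-cong (reflexive (cong (ballotSum (suc e)) (≡.sym (+-identityʳ s)))) (ballotSum-unfold e (suc s)) ⟩
      ballotSum (suc e) (s + 0) ⊕ sum (suc e) (λ i → ballotSum (e ∸ i) (suc s + i))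
        ≈⟨ ⊕-cong refl (sum-cong (suc e) (λ i _ → reflexive (cong (ballotSum (e ∸ i)) (≡.sym (+-suc s i))))) ⟩
      sum (suc (suc e)) (λ i → ballotSum (suc e ∸ i) (s + i))
        ∎

    BallotRow : ℕ → Set ℓ
    BallotRow n = ∀ s → s ≤ n → x (suc n) (suc s) ≈ ballotSum (n ∸ s) s

    BallotForm : Set ℓ
    BallotForm = ∀ n → BallotRow n

    rowTail-ballotSum : ∀ {n} → BallotRow n → ∀ {s} → s ≤ n →
                        sumFromTo R (x (suc n)) (suc s) (suc n) ≈ ballotSum (n ∸ s) (suc s)
    rowTail-ballotSum {n} row {s} s≤n = begin
      sumFromTo R (x (suc n)) (suc s) (suc n)
        ≡⟨ cong (sumFromTo R (x (suc n)) (suc s) ∘ suc) (≡.sym (m+[n∸m]≡n s≤n)) ⟩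
      sumFromTo R (x (suc n)) (suc s) (suc s + (n ∸ s))
        ≈⟨ sumFromTo-sum (x (suc n)) (suc s) (n ∸ s) ⟩
      sum (suc (n ∸ s)) (λ i → x (suc n) (suc (s + i)))
        ≈⟨ sum-cong (suc (n ∸ s)) entry ⟩
      sum (suc (n ∸ s)) (λ i → ballotSum (n ∸ s ∸ i) (s + i))
        ≈⟨ ballotSum-unfold (n ∸ s) s ⟨
      ballotSum (n ∸ s) (suc s)
        ∎
      where
      entry : ∀ i → i < suc (n ∸ s) → x (suc n) (suc (s + i)) ≈ ballotSum (n ∸ s ∸ i) (s + i)
      entry i (s≤s i≤n∸s) =
        trans (row (s + i) (≤-trans (+-monoʳ-≤ s i≤n∸s) (≤-reflexive (m+[n∸m]≡n s≤n))))
              (reflexive (cong (λ d → ballotSum d (s + i)) (≡.sym (∸-+-assoc n s i))))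

    triangleSystem⇒ballotForm : CatalanTriangleSystem R x → BallotForm
    triangleSystem⇒ballotForm cts n       zero    _         = sym (ballotSum-zero n)
    triangleSystem⇒ballotForm cts (suc n) (suc s) (s≤s s≤n) =
      trans (cts (suc n) (suc s) (s≤s z≤n) (s≤s z≤n) (s≤s s≤n))
            (rowTail-ballotSum (triangleSystem⇒ballotForm cts n) s≤n)

    ballotForm⇒triangleSystem : BallotForm → CatalanTriangleSystem R x
    ballotForm⇒triangleSystem form (suc n) (suc s) _ _ (s≤s s≤n) =
      trans (form (suc n) (suc s) (s≤s s≤n)) (sym (rowTail-ballotSum (form n) s≤n))

    triangleSystem⇔ballotForm : CatalanTriangleSystem R x ⇔ BallotForm
    triangleSystem⇔ballotForm = mk⇔ triangleSystem⇒ballotForm ballotForm⇒triangleSystem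

    trapezoidSum-ballotSum : ∀ d s →
      sumFromTo R (λ h → catalanTrapezoid (suc s) h (h + suc (suc s) ∸ 2) × x ((d ∸ h) + 1) 1) 0 d
        ≈ ballotSum d (suc s)
    trapezoidSum-ballotSum d s =
      trans (sumFromTo-sum _ 0 d) (sum-cong (suc d) (λ h _ → reflexive (cong₂ _×_ (coefficient h) (entry h))))
      where
      coefficient : ∀ h → catalanTrapezoid (suc s) h (h + suc (suc s) ∸ 2) ≡ ballot h (suc s)
      coefficient h =
        ≡.trans (cong (catalanTrapezoid (suc s) h) (+-∸-assoc h (s≤s (s≤s z≤n)))) (catalanTrapezoid-ballot h s)
      entry : ∀ h → x ((d ∸ h) + 1) 1 ≡ x (suc (d ∸ h)) 1
      entry h = cong (λ k → x k 1) (+-comm (d ∸ h) 1)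

    trapezoidFormula⇒ballotForm : TrapezoidFormula R x → BallotForm
    trapezoidFormula⇒ballotForm tf n       zero    _         = sym (ballotSum-zero n)
    trapezoidFormula⇒ballotForm tf (suc n) (suc s) (s≤s s≤n) =
      trans (tf (suc (suc n)) (suc (suc s)) (s≤s (s≤s z≤n)) (s≤s (s≤s z≤n)) (s≤s (s≤s s≤n)))
            (trapezoidSum-ballotSum (n ∸ s) s)

    ballotForm⇒trapezoidFormula : BallotForm → TrapezoidFormula R x
    ballotForm⇒trapezoidFormula form (suc (suc n)) (suc (suc s)) _ (s≤s (s≤s _)) (s≤s (s≤s s≤n)) =
      trans (form (suc n) (suc s) (s≤s s≤n)) (sym (trapezoidSum-ballotSum (n ∸ s) s))

    trapezoidFormula⇔ballotForm : TrapezoidFormula R x ⇔ BallotForm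
    trapezoidFormula⇔ballotForm = mk⇔ trapezoidFormula⇒ballotForm ballotForm⇒trapezoidFormula

theorem3p1 : ∀ {c ℓ} (R : CommutativeRing c ℓ) (x : ℕ → ℕ → CommutativeRing.Carrier R) →
               CatalanTriangleSystem R x ⇔ TrapezoidFormula R x
theorem3p1 R x = ⇔-sym (trapezoidFormula⇔ballotForm R x) ⇔-∘ triangleSystem⇔ballotForm R x
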